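{- Let $\mathcal{X}=\{x_1,\dots,x_N\}\subset\mathbb{R}^d$ be a finite dataset equipped with a metric $d$, and let $0\le k\le N-2$. Let $\{\mathcal{C}_i^k\}_{i=1}^{I_k}$ and $\{\mathcal{C}_i^{k+1}\}_{i=1}^{I_{k+1}}$ be the $k$- and $(k+1)$-nearest-neighbor cluster sets of $\mathcal{X}$ (defined in the context). Then for every $i\in\{1,\dots,I_{k+1}\}$ there is a set of indices $J_i\subseteq\{1,\dots,I_k\}$ with $|J_i|\ge1$ such that $\mathcal{C}_i^{k+1}=\bigcup_{j\in J_i}\mathcal{C}_j^k$.
   Context: For $x\in\mathcal{X}$, order the points of $\mathcal{X}\setminus\{x\}$ by nondecreasing distance $d(x,\cdot)$ (ties broken by a fixed rule), and let $\mathcal{N}_k(x)$ be the set of the first $k$ points in this order (the $k$ nearest neighbors of $x$; $\mathcal{N}_0(x)=\emptyset$). The $k$-nearest-neighbor cluster set $\{\mathcal{C}_i^k\}_{i=1}^{I_k}$ is a partition of $\mathcal{X}$ into pairwise disjoint sets whose union is $\mathcal{X}$, such that each cluster contains the $k$ nearest neighbors of every one of its elements ($\mathcal{N}_k(x)\subseteq\mathcal{C}_i^k$ for all $x\in\mathcal{C}_i^k$), and $I_k$ is the maximum number of clusters among all partitions with this property. -}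

module Defs where

open import Level using (Level)
open import Data.Nat using (ℕ; _<_; _≤_)
open import Data.Fin using (Fin)
import Data.Fin as F
import Data.Fin.Properties as FP
open import Data.List using (List; filter; length)
open import Data.List using () renaming (allFin to allFinL)
open import Data.Product using (∃; _×_)
open import Data.Sum using (_⊎_)
open import Relation.Nullary using (¬_; Dec)
open import Relation.Nullary.Decidable using (_×-dec_; _⊎-dec_; ¬?)
open import Relation.Binary.Bundles using (StrictTotalOrder)
open import Relation.Binary.PropositionalEquality using (_≡_; _≢_)

-- k-nearest-neighbour clustering of a finite dataset X = {x₀,…,x_{N-1}}
-- (points represented by their indices Fin N), with distances
-- d : Fin N → Fin N → D valued in an arbitrary strict total order D
-- (the real numbers being the case of the paper).
module KNN {c ℓ₁ ℓ₂ : Level} (D : StrictTotalOrder c ℓ₁ ℓ₂)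
           {N : ℕ} (d : Fin N → Fin N → StrictTotalOrder.Carrier D) where

  open StrictTotalOrder D using (_≈_) renaming (_<_ to _<ᴰ_; _<?_ to _<ᴰ?_; _≟_ to _≟ᴰ_)

  Before : Fin N → Fin N → Fin N → Set (ℓ₁ Level.⊔ ℓ₂)
  Before x z y = (d x z <ᴰ d x y) ⊎ ((d x z ≈ d x y) × (z F.< y))

  before? : ∀ x z y → Dec (Before x z y)
  before? x z y = (d x z <ᴰ? d x y) ⊎-dec ((d x z ≟ᴰ d x y) ×-dec (z FP.<? y))

  -- position (0-based) of y in the ordering of X ∖ {x}
  rank : Fin N → Fin N → ℕ
  rank x y = length (filter (λ z → ¬? (z FP.≟ x) ×-dec before? x z y) (allFinL N))

  NN : ℕ → Fin N → Fin N → Set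
  NN k x y = (y ≢ x) × (rank x y < k)

  -- A partition of X into I nonempty pairwise disjoint clusters is given
  -- by a surjective labelling c : Fin N → Fin I (cluster i = c⁻¹(i)).
  Surj : {I : ℕ} → (Fin N → Fin I) → Set
  Surj {I} cl = (i : Fin I) → ∃ λ x → cl x ≡ i

  IsKClustering : ℕ → (I : ℕ) → (Fin N → Fin I) → Set
  IsKClustering k I cl = Surj cl × (∀ x y → NN k x y → cl y ≡ cl x)

  IsKClusterSet : ℕ → (I : ℕ) → (Fin N → Fin I) → Set
  IsKClusterSet k I cl =
    IsKClustering k I cl × (∀ (I′ : ℕ) (cl′ : Fin N → Fin I′) → IsKClustering k I′ cl′ → I′ ≤ I)

-- A (k+1)-clustering is in particular a k-clustering, since 𝒩_k(x) ⊆ 𝒩_{k+1}(x).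
-- If some k-cluster met two (k+1)-clusters, cutting it along them would give a
-- k-clustering with one cluster more, contradicting the maximality of I_k.
-- Hence the maximal k-clustering refines every (k+1)-clustering, and each
-- (k+1)-cluster is the union of the k-clusters it meets.
module Submission where

open import Defs
open import Level using (Level)
open import Data.Nat using (ℕ; _+_; _≤_; suc; s≤s; z≤n)
open import Data.Nat.Properties using (≤-trans; m≤m+n; <-irrefl)
open import Data.Fin using (Fin; zero; suc; _≟_)
open import Data.Fin.Properties using (any?)
open import Data.Fin.Subset using (Subset; _∈_; ∣_∣)
open import Data.Fin.Subset.Properties using (x∈p⇒∣p-x∣<∣p∣)
open import Data.Vec using (tabulate)
open import Data.Vec.Properties using (lookup∘tabulate; []=⇒lookup; lookup⇒[]=)
open import Data.Bool using (Bool; true; false; if_then_else_)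
open import Data.Product using (Σ; ∃; _×_; _,_; proj₁; proj₂)
open import Data.Empty using (⊥-elim)
open import Function using (_∘_)
open import Function.Bundles using (_⇔_; mk⇔; Equivalence)
open import Relation.Unary using (Pred; Decidable)
open import Relation.Nullary using (Dec; yes; no; does)
open import Relation.Nullary.Decidable using (_×-dec_; ¬?; dec-true; dec-false)
open import Relation.Binary.Bundles using (StrictTotalOrder)
open import Relation.Binary.PropositionalEquality using (_≡_; _≢_; refl; sym; trans; cong; cong₂)

does≡true⇒ : ∀ {a} {A : Set a} (a? : Dec A) → does a? ≡ true → A
does≡true⇒ (yes a) _ = a

∈-tabulate-does : ∀ {n p} {P : Pred (Fin n) p} (P? : Decidable P) {j : Fin n} →
                  j ∈ tabulate (does ∘ P?) ⇔ P j
∈-tabulate-does P? {j} = mk⇔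
  (λ j∈ → does≡true⇒ (P? j) (trans (sym (lookup∘tabulate _ j)) ([]=⇒lookup j∈)))
  (λ pj → lookup⇒[]= j _ (trans (lookup∘tabulate _ j) (dec-true (P? j) pj)))

∈⇒1≤∣p∣ : ∀ {n} {p : Subset n} {j : Fin n} → j ∈ p → 1 ≤ ∣ p ∣
∈⇒1≤∣p∣ j∈p = ≤-trans (s≤s z≤n) (x∈p⇒∣p-x∣<∣p∣ j∈p)

module _ {N I M : ℕ} (f : Fin N → Fin I) (g : Fin N → Fin M) where

  meets? : ∀ i j → Dec (∃ λ z → f z ≡ j × g z ≡ i)
  meets? i j = any? λ z → (f z ≟ j) ×-dec (g z ≟ i)

  fibreImage : Fin M → Subset I
  fibreImage i = tabulate (does ∘ meets? i)

  ∈-fibreImage : ∀ {i j} → j ∈ fibreImage i ⇔ ∃ λ z → f z ≡ j × g z ≡ i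
  ∈-fibreImage {i} = ∈-tabulate-does (meets? i)

  fibre≡⋃fibres : (∀ x y → f x ≡ f y → g x ≡ g y) →
                  ∀ i x → g x ≡ i ⇔ f x ∈ fibreImage i
  fibre≡⋃fibres factors i x = mk⇔
    (λ gx≡i → Equivalence.from ∈-fibreImage (x , refl , gx≡i))
    (λ fx∈ → let (z , fz≡fx , gz≡i) = Equivalence.to ∈-fibreImage fx∈
             in trans (factors x z (sym fz≡fx)) gz≡i)

module _ {c ℓ₁ ℓ₂ : Level} (D : StrictTotalOrder c ℓ₁ ℓ₂) {N : ℕ}
         (d : Fin N → Fin N → StrictTotalOrder.Carrier D) where
  open KNN D d

  Closed : ∀ {a} {A : Set a} → ℕ → (Fin N → A) → Set a
  Closed k f = ∀ x y → NN k x y → f y ≡ f x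

  NN-mono : ∀ {k k′ x y} → k ≤ k′ → NN k x y → NN k′ x y
  NN-mono k≤k′ (y≢x , rank<k) = y≢x , ≤-trans rank<k k≤k′

  Closed-antitone : ∀ {a} {A : Set a} {k k′} {f : Fin N → A} →
                    k ≤ k′ → Closed k′ f → Closed k f
  Closed-antitone k≤k′ closed x y = closed x y ∘ NN-mono k≤k′

  module _ {I : ℕ} (cl : Fin N → Fin I) (marked : Fin N → Bool) where

    splitOff : Fin N → Fin (suc I)
    splitOff z = if marked z then zero else suc (cl z)

    splitOff-closed : ∀ {k} → Closed k cl → Closed k marked → Closed k splitOff
    splitOff-closed closed marked-closed x y nn =
      cong₂ (λ b j → if b then zero else suc j) (marked-closed x y nn) (closed x y nn)

    splitOff-surjective : ∀ {x y} → Surj cl → marked y ≡ true → marked x ≡ false →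
                          (∀ z → marked z ≡ true → cl z ≡ cl x) → Surj splitOff
    splitOff-surjective {y = y} _ y-marked _ _ zero =
      y , cong (λ b → if b then zero else suc (cl y)) y-marked
    splitOff-surjective {x} surj _ x-unmarked inCluster (suc j) with j ≟ cl x
    ... | yes refl = x , cong (λ b → if b then zero else suc (cl x)) x-unmarked
    ... | no j≢clx with surj j
    ...   | z , refl = z , unmarked
      where
      unmarked : splitOff z ≡ suc (cl z)
      unmarked with marked z in eq
      ... | true  = ⊥-elim (j≢clx (inCluster z eq))
      ... | false = refl

  maximal-refines : ∀ {k I M} {cl : Fin N → Fin I} → IsKClusterSet k I cl →
                    (cl′ : Fin N → Fin M) → Closed k cl′ →
                    ∀ x y → cl x ≡ cl y → cl′ x ≡ cl′ y
  maximal-refines {k} {I} {cl = cl} ((surj , closed) , maximal) cl′ closed′ x y clx≡cly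
    with cl′ x ≟ cl′ y
  ... | yes eq = eq
  ... | no neq = ⊥-elim (<-irrefl refl (maximal (suc I) (splitOff cl marked) finer))
    where
    Marked : Fin N → Set
    Marked z = cl z ≡ cl x × cl′ z ≢ cl′ x

    marked? : ∀ z → Dec (Marked z)
    marked? z = (cl z ≟ cl x) ×-dec ¬? (cl′ z ≟ cl′ x)

    marked : Fin N → Bool
    marked = does ∘ marked?

    marked-closed : Closed k marked
    marked-closed a b nn =
      cong₂ (λ i j → does ((i ≟ cl x) ×-dec ¬? (j ≟ cl′ x))) (closed a b nn) (closed′ a b nn)

    inCluster : ∀ z → marked z ≡ true → cl z ≡ cl x
    inCluster z eq = proj₁ (does≡true⇒ (marked? z) eq)

    finer : IsKClustering k (suc I) (splitOff cl marked)
    finer = splitOff-surjective cl marked surj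
              (dec-true (marked? y) (sym clx≡cly , neq ∘ sym))
              (dec-false (marked? x) (λ (_ , cl′x≢cl′x) → cl′x≢cl′x refl))
              inCluster
          , splitOff-closed cl marked closed marked-closed

lemma2 : ∀ {c ℓ₁ ℓ₂ : Level} (D : StrictTotalOrder c ℓ₁ ℓ₂) (N : ℕ)
    (d : Fin N → Fin N → StrictTotalOrder.Carrier D)
    (k : ℕ) → k + 2 ≤ N →
    (I : ℕ) (cl : Fin N → Fin I) → KNN.IsKClusterSet D d k I cl →
    (I′ : ℕ) (cl′ : Fin N → Fin I′) → KNN.IsKClusterSet D d (k + 1) I′ cl′ →
    (i : Fin I′) →
    Σ (Subset I) λ J → (1 ≤ ∣ J ∣) × (∀ (x : Fin N) → (cl′ x ≡ i) ⇔ (cl x ∈ J))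
lemma2 D N d k _ I cl clusterSet I′ cl′ ((surj′ , closed′) , _) i =
  fibreImage cl cl′ i , ∈⇒1≤∣p∣ (Equivalence.to (union x₀) gx₀≡i) , union
  where
  refines : ∀ x y → cl x ≡ cl y → cl′ x ≡ cl′ y
  refines = maximal-refines D d clusterSet cl′ (Closed-antitone D d (m≤m+n k 1) closed′)

  union : ∀ x → cl′ x ≡ i ⇔ cl x ∈ fibreImage cl cl′ i
  union = fibre≡⋃fibres cl cl′ refines i

  x₀ : Fin N
  x₀ = proj₁ (surj′ i)

  gx₀≡i : cl′ x₀ ≡ i
  gx₀≡i = proj₂ (surj′ i)
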